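{- Let $L$ be a lattice that is isomorphic to the configuration space of some convergent Chip Firing Game. Then every interval $[a,b]=\{x\in L: a\le x\le b\}$ (with $a\le b$ in $L$) is also isomorphic to the configuration space of some convergent Chip Firing Game.
   Context: A Chip Firing Game (CFG) is given by a finite directed multigraph $G=(V,E)$ and an initial configuration $\sigma_0:V\to\mathbb{N}$ (numbers of chips on vertices). Firing rule: if in configuration $\sigma$ a vertex $v$ holds at least $d^+(v)$ chips (its out-degree), one may fire $v$, sending one chip along each outgoing edge of $v$. A CFG is convergent if it cannot be played forever from the initial configuration; it then reaches a unique final configuration in which no firing is possible. The configuration space of a convergent CFG is the set of configurations reachable from the initial configuration, ordered by $\sigma\le\sigma'$ iff $\sigma'$ is reachable from $\sigma$ by a (possibly empty) sequence of firings; it is a finite lattice. -}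

module Defs where

open import Level using (Level; _⊔_) renaming (zero to lzero)
open import Data.Nat using (ℕ; _+_; _∸_) renaming (_≤_ to _≤ℕ_)
open import Data.Fin using (Fin; _≟_)
open import Data.List using (map; allFin)
open import Data.Nat.ListAction using (sum)
open import Data.Product using (Σ; _×_; _,_; proj₁; proj₂)
open import Relation.Nullary using (yes; no)
open import Relation.Binary.PropositionalEquality using (_≡_)
open import Relation.Binary.Core using (Rel)
open import Relation.Binary.Construct.Closure.ReflexiveTransitive using (Star)
open import Relation.Binary.Morphism.Structures using (IsOrderIsomorphism)
open import Relation.Binary.Lattice.Bundles using (Lattice)
open import Induction.WellFounded using (Acc)

-- A finite directed multigraph on the vertex set Fin n, given by its
-- edge-multiplicity matrix: mult v w = number of edges from v to w
-- (loops v → v are allowed).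
Multigraph : ℕ → Set
Multigraph n = Fin n → Fin n → ℕ

Config : ℕ → Set
Config n = Fin n → ℕ

module _ {n : ℕ} (G : Multigraph n) where

  outdeg : Fin n → ℕ
  outdeg v = sum (map (G v) (allFin n))

  -- the configuration obtained by firing v (meaningful when v is firable)
  fire : Config n → Fin n → Config n
  fire σ v w with w ≟ v
  ... | yes _ = (σ w ∸ outdeg v) + G v w
  ... | no  _ = σ w + G v w

  Step : Config n → Config n → Set
  Step σ σ' = Σ (Fin n) λ v → (outdeg v ≤ℕ σ v) × (∀ w → σ' w ≡ fire σ v w)

  Reach : Config n → Config n → Set
  Reach = Star Step

  -- convergence: the game cannot be played forever from σ₀, i.e. σ₀ is
  -- accessible for the converse of the step relation (every play terminates)
  Convergent : Config n → Set
  Convergent σ₀ = Acc (λ σ' σ → Step σ σ') σ₀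

  CS : Config n → Set
  CS σ₀ = Σ (Config n) (Reach σ₀)

  _≈CS_ : {σ₀ : Config n} → Rel (CS σ₀) lzero
  c ≈CS d = ∀ w → proj₁ c w ≡ proj₁ d w

  _≤CS_ : {σ₀ : Config n} → Rel (CS σ₀) lzero
  c ≤CS d = Reach (proj₁ c) (proj₁ d)

IsCFGSpace : ∀ {a ℓ₁ ℓ₂} (A : Set a) → Rel A ℓ₁ → Rel A ℓ₂ → Set (a ⊔ ℓ₁ ⊔ ℓ₂)
IsCFGSpace A _≈_ _≤_ =
  Σ ℕ λ n → Σ (Multigraph n) λ G → Σ (Config n) λ σ₀ →
    Convergent G σ₀ ×
    Σ (A → CS G σ₀) λ f →
      IsOrderIsomorphism _≈_ (_≈CS_ G {σ₀}) _≤_ (_≤CS_ G {σ₀}) f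

module _ {c ℓ₁ ℓ₂} (L : Lattice c ℓ₁ ℓ₂) where
  open Lattice L

  Interval : Carrier → Carrier → Set (c ⊔ ℓ₂)
  Interval a b = Σ Carrier λ x → (a ≤ x) × (x ≤ b)

  _≈I_ : ∀ {a b} → Rel (Interval a b) ℓ₁
  x ≈I y = proj₁ x ≈ proj₁ y

  _≤I_ : ∀ {a b} → Rel (Interval a b) ℓ₂
  x ≤I y = proj₁ x ≤ proj₁ y

{-# OPTIONS --safe #-}
module Submission where

-- Through the order isomorphism the interval [a, b] becomes the set of configurations σ that are
-- reachable from α = f a and reach β = f b. In a convergent game the shot vector of a play (how often
-- each vertex fired) depends only on its endpoints, and by the least action principle these σ are
-- exactly the configurations reached from α by plays whose shot vector stays below the shot vector K
-- of a play from α to β. So it suffices to build a convergent game that plays G from α under the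
-- firing budget K: every vertex v is split into copies each firing at most once, in order, and only
-- the first K v copies can ever fire.

open import Defs
open import Relation.Binary.Lattice.Bundles using (Lattice)

open import Data.Nat using (ℕ; zero; suc; _+_; _*_; _∸_; _≤_; _<_; _≤?_; _<?_; z≤n; s≤s; s≤s⁻¹)
open import Data.Nat.Properties hiding (_≟_)
open import Data.Nat.Properties using () renaming (_≟_ to _≟ℕ_)
open import Data.Nat.Induction using (<-wellFounded)
open import Data.Nat.Tactic.RingSolver using (solve-∀)
import Data.Nat.ListAction as List
open import Data.Fin using (Fin; toℕ; fromℕ<; _≟_; _↑ˡ_; _↑ʳ_; combine; remQuot) renaming (zero to 0F; suc to 1+)
import Data.Fin.Properties as Fin
open import Data.List using (map; allFin; tabulate)
import Data.List.Properties as List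
open import Data.Vec using (lookup) renaming (tabulate to tabulateᵛ)
import Data.Vec.Properties as Vec
open import Data.Product using (Σ; ∃; ∃-syntax; _×_; _,_; proj₁; proj₂; uncurry)
open import Data.Sum using (_⊎_; inj₁; inj₂)
open import Function using (id; _∘_)
open import Relation.Nullary using (¬_; Dec; yes; no; contradiction)
open import Relation.Nullary.Decidable using (_×-dec_)
open import Relation.Binary.PropositionalEquality
open import Relation.Binary.Construct.Closure.ReflexiveTransitive using (ε; _◅_; _◅◅_)
open import Relation.Binary.Morphism.Structures using (IsOrderIsomorphism)
open import Induction.WellFounded using (Acc; acc)
open import Algebra.Properties.Semiring.Sum +-*-semiring
  using (sum; sum-syntax; sum-cong-≗; ∑-distrib-+; *-distribˡ-sum; sum-replicate-zero)

sum-map-allFin : ∀ {n} (h : Fin n → ℕ) → List.sum (map h (allFin n)) ≡ sum h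
sum-map-allFin h = trans (cong List.sum (List.map-tabulate id h)) (sum-tabulate h)
  where
  sum-tabulate : ∀ {n} (h : Fin n → ℕ) → List.sum (tabulate h) ≡ sum h
  sum-tabulate {zero} h = refl
  sum-tabulate {suc n} h = cong (h 0F +_) (sum-tabulate (h ∘ 1+))

∑-const : ∀ m a → ∑[ i < m ] a ≡ m * a
∑-const zero a = refl
∑-const (suc m) a = cong (a +_) (∑-const m a)

∑-mono-≤ : ∀ {n} {f g : Fin n → ℕ} → (∀ i → f i ≤ g i) → sum f ≤ sum g
∑-mono-≤ {zero} f≤g = z≤n
∑-mono-≤ {suc n} f≤g = +-mono-≤ (f≤g 0F) (∑-mono-≤ (f≤g ∘ 1+))

term≤∑ : ∀ {n} (h : Fin n → ℕ) i → h i ≤ sum h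
term≤∑ h 0F = m≤m+n (h 0F) _
term≤∑ h (1+ i) = ≤-trans (term≤∑ (h ∘ 1+) i) (m≤n+m _ (h 0F))

∑-↑ : ∀ m {n} (h : Fin (m + n) → ℕ) → sum h ≡ ∑[ i < m ] h (i ↑ˡ n) + ∑[ j < n ] h (m ↑ʳ j)
∑-↑ zero h = refl
∑-↑ (suc m) h = trans (cong (h 0F +_) (∑-↑ m (h ∘ 1+))) (sym (+-assoc (h 0F) _ _))

∑-combine : ∀ m n (h : Fin (m * n) → ℕ) → sum h ≡ ∑[ i < m ] ∑[ j < n ] h (combine i j)
∑-combine zero n h = refl
∑-combine (suc m) n h = trans (∑-↑ n h) (cong (∑[ j < n ] h (j ↑ˡ (m * n)) +_) (∑-combine m n (h ∘ (n ↑ʳ_))))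

δ : ℕ → ℕ → ℕ
δ zero zero = 1
δ zero (suc b) = 0
δ (suc a) zero = 0
δ (suc a) (suc b) = δ a b

δ-diag : ∀ a → δ a a ≡ 1
δ-diag zero = refl
δ-diag (suc a) = δ-diag a

δ-off : ∀ {a b} → a ≢ b → δ a b ≡ 0
δ-off {zero} {zero} a≢b = contradiction refl a≢b
δ-off {zero} {suc b} a≢b = refl
δ-off {suc a} {zero} a≢b = refl
δ-off {suc a} {suc b} a≢b = δ-off (a≢b ∘ cong suc)

∑-δ : ∀ {m} (j : Fin m) (h : Fin m → ℕ) → ∑[ i < m ] (δ (toℕ i) (toℕ j) * h i) ≡ h j
∑-δ {suc m} 0F h = trans (cong₂ _+_ (*-identityˡ (h 0F)) (sum-replicate-zero m)) (+-identityʳ (h 0F))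
∑-δ {suc m} (1+ j) h = ∑-δ j (h ∘ 1+)

∑-δ′ : ∀ {m s} → s < m → (a : ℕ) → ∑[ i < m ] (δ (toℕ i) s * a) ≡ a
∑-δ′ {m} s<m a = subst (λ s → ∑[ i < m ] (δ (toℕ i) s * a) ≡ a) (Fin.toℕ-fromℕ< s<m) (∑-δ (fromℕ< s<m) (λ _ → a))

infixl 6 _+̇_
infix 4 _≤̇_

_+̇_ : ∀ {n} → (Fin n → ℕ) → (Fin n → ℕ) → Fin n → ℕ
(c +̇ c') w = c w + c' w

_≤̇_ : ∀ {n} → (Fin n → ℕ) → (Fin n → ℕ) → Set
c ≤̇ c' = ∀ w → c w ≤ c' w

0̇ : ∀ {n} → Fin n → ℕ
0̇ _ = 0

unit : ∀ {n} → Fin n → Fin n → ℕ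
unit v w = δ (toℕ w) (toℕ v)

unit-diag : ∀ {n} (v : Fin n) → unit v v ≡ 1
unit-diag v = δ-diag (toℕ v)

unit-off : ∀ {n} {v w : Fin n} → w ≢ v → unit v w ≡ 0
unit-off w≢v = δ-off (w≢v ∘ Fin.toℕ-injective)

+̇unit-self : ∀ {n} (c : Fin n → ℕ) v → (c +̇ unit v) v ≡ suc (c v)
+̇unit-self c v = trans (cong (c v +_) (unit-diag v)) (+-comm (c v) 1)

+̇unit-other : ∀ {n} (c : Fin n → ℕ) {v w} → w ≢ v → (c +̇ unit v) w ≡ c w
+̇unit-other c {w = w} w≢v = trans (cong (c w +_) (unit-off w≢v)) (+-identityʳ (c w))

+̇unit-≤̇ : ∀ {n} {c m : Fin n → ℕ} v → c ≤̇ m → c v < m v → c +̇ unit v ≤̇ m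
+̇unit-≤̇ {c = c} {m} v c≤m cv<m w with w ≟ v
... | yes refl = subst (_≤ m v) (sym (+̇unit-self c v)) cv<m
... | no w≢v = subst (_≤ m w) (sym (+̇unit-other c w≢v)) (c≤m w)

∑-+̇unit : ∀ {n} (c : Fin n → ℕ) v → sum (c +̇ unit v) ≡ suc (sum c)
∑-+̇unit c v = begin
  sum (c +̇ unit v)      ≡⟨ ∑-distrib-+ c (unit v) ⟩
  sum c + sum (unit v)  ≡⟨ cong (sum c +_) (trans (sum-cong-≗ (λ w → sym (*-identityʳ (unit v w)))) (∑-δ v (λ _ → 1))) ⟩
  sum c + 1             ≡⟨ +-comm (sum c) 1 ⟩
  suc (sum c)           ∎
  where open ≡-Reasoning

module Game {n : ℕ} (G : Multigraph n) where

  Terminal : Config n → Set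
  Terminal σ = ∀ v → σ v < outdeg G v

  fire-self : ∀ σ v → fire G σ v v ≡ (σ v ∸ outdeg G v) + G v v
  fire-self σ v with v ≟ v
  ... | yes _ = refl
  ... | no v≢v = contradiction refl v≢v

  fire-other : ∀ σ {v w} → w ≢ v → fire G σ v w ≡ σ w + G v w
  fire-other σ {v} {w} w≢v with w ≟ v
  ... | yes w≡v = contradiction w≡v w≢v
  ... | no _ = refl

  fire-cong : ∀ {σ σ'} → σ ≗ σ' → ∀ v → fire G σ v ≗ fire G σ' v
  fire-cong σ≗σ' v w with w ≟ v
  ... | yes _ = cong (λ k → (k ∸ outdeg G v) + G v w) (σ≗σ' w)
  ... | no _ = cong (_+ G v w) (σ≗σ' w)

  step-respˡ : ∀ {σ σ' τ} → σ ≗ σ' → Step G σ τ → Step G σ' τ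
  step-respˡ σ≗σ' (v , fv , τ≗fire) =
    v , subst (outdeg G v ≤_) (σ≗σ' v) fv , λ w → trans (τ≗fire w) (fire-cong σ≗σ' v w)

  step-respʳ : ∀ {σ τ τ'} → τ ≗ τ' → Step G σ τ → Step G σ τ'
  step-respʳ τ≗τ' (v , fv , τ≗fire) = v , fv , λ w → trans (sym (τ≗τ' w)) (τ≗fire w)

  step◅reach-respʳ : ∀ {σ ρ τ τ'} → τ ≗ τ' → Step G σ ρ → Reach G ρ τ → Reach G σ τ'
  step◅reach-respʳ τ≗τ' s ε = step-respʳ τ≗τ' s ◅ ε
  step◅reach-respʳ τ≗τ' s (t ◅ p) = s ◅ step◅reach-respʳ τ≗τ' t p

  reach-resp : ∀ {σ σ' τ τ'} → σ ≗ σ' → τ ≗ τ' → Reach G σ τ → Reach G σ' τ' ⊎ σ' ≗ τ'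
  reach-resp σ≗σ' τ≗τ' ε = inj₂ (λ w → trans (sym (σ≗σ' w)) (τ≗τ' w))
  reach-resp σ≗σ' τ≗τ' (s ◅ p) = inj₁ (step◅reach-respʳ τ≗τ' (step-respˡ σ≗σ' s) p)

  convergent-after : ∀ {σ τ} → Convergent G σ → Reach G σ τ → Convergent G τ
  convergent-after σ↓ ε = σ↓
  convergent-after (acc rs) (s ◅ p) = convergent-after (rs s) p

  stabilise : ∀ {σ} → Convergent G σ → ∃[ τ ] Reach G σ τ × Terminal τ
  stabilise {σ} (acc rs) with Fin.any? (λ v → outdeg G v ≤? σ v)
  ... | yes (v , fv) with stabilise (rs (v , fv , λ _ → refl))
  ...   | τ , q , τ-terminal = τ , (v , fv , λ _ → refl) ◅ q , τ-terminal
  stabilise {σ} (acc rs) | no none = σ , ε , λ v → ≰⇒> (λ fv → none (v , fv))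

  infixl 6 _+shots_

  _+shots_ : ∀ {σ τ} → (Fin n → ℕ) → Reach G σ τ → Fin n → ℕ
  c +shots ε = c
  c +shots ((v , _) ◅ p) = (c +̇ unit v) +shots p

  shots : ∀ {σ τ} → Reach G σ τ → Fin n → ℕ
  shots p = 0̇ +shots p

  +shots-◅◅ : ∀ {σ τ ρ} c (p : Reach G σ τ) (q : Reach G τ ρ) → c +shots (p ◅◅ q) ≡ (c +shots p) +shots q
  +shots-◅◅ c ε q = refl
  +shots-◅◅ c ((v , _) ◅ p) q = +shots-◅◅ (c +̇ unit v) p q

  +shots-≥ : ∀ {σ τ} c (p : Reach G σ τ) → c ≤̇ c +shots p
  +shots-≥ c ε w = ≤-refl
  +shots-≥ c ((v , _) ◅ p) w = ≤-trans (m≤m+n (c w) (unit v w)) (+shots-≥ (c +̇ unit v) p w)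

  +shots-split : ∀ {σ τ} c (p : Reach G σ τ) → c +shots p ≗ c +̇ shots p
  +shots-split c ε w = sym (+-identityʳ (c w))
  +shots-split c ((v , _) ◅ p) w = begin
    ((c +̇ unit v) +shots p) w     ≡⟨ +shots-split (c +̇ unit v) p w ⟩
    c w + unit v w + shots p w    ≡⟨ +-assoc (c w) (unit v w) (shots p w) ⟩
    c w + (unit v w + shots p w)  ≡⟨ cong (c w +_) (sym (+shots-split (unit v) p w)) ⟩
    c w + (unit v +shots p) w     ∎
    where open ≡-Reasoning

  inflow : (Fin n → ℕ) → Fin n → ℕ
  inflow c w = ∑[ u < n ] (G u w * c u)

  inflow-0̇ : ∀ w → inflow 0̇ w ≡ 0
  inflow-0̇ w = trans (sum-cong-≗ (λ u → *-zeroʳ (G u w))) (sum-replicate-zero n)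

  inflow-+̇ : ∀ c c' w → inflow (c +̇ c') w ≡ inflow c w + inflow c' w
  inflow-+̇ c c' w = trans (sum-cong-≗ (λ u → *-distribˡ-+ (G u w) (c u) (c' u)))
                          (∑-distrib-+ (λ u → G u w * c u) (λ u → G u w * c' u))

  inflow-unit : ∀ v w → inflow (unit v) w ≡ G v w
  inflow-unit v w = trans (sum-cong-≗ (λ u → *-comm (G u w) (unit v u))) (∑-δ v (λ u → G u w))

  inflow-mono : ∀ {c c'} → c ≤̇ c' → inflow c ≤̇ inflow c'
  inflow-mono c≤c' w = ∑-mono-≤ (λ u → *-monoʳ-≤ (G u w) (c≤c' u))

  -- The conservation law τ = σ + inflow c − d⁺ ⊙ c of firing every w exactly c w times,
  -- written without truncated subtraction.
  Balanced : Config n → (Fin n → ℕ) → Config n → Set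
  Balanced σ c τ = ∀ w → τ w + outdeg G w * c w ≡ σ w + inflow c w

  balanced-refl : ∀ σ → Balanced σ 0̇ σ
  balanced-refl σ w = cong (σ w +_) (trans (*-zeroʳ (outdeg G w)) (sym (inflow-0̇ w)))

  balanced-fire : ∀ σ v → outdeg G v ≤ σ v → Balanced σ (unit v) (fire G σ v)
  balanced-fire σ v fv w = by-cases (w ≟ v)
    where
    open ≡-Reasoning
    rearrange : ∀ a b k → a + b + k * 1 ≡ a + k + b
    rearrange = solve-∀
    by-cases : Dec (w ≡ v) → fire G σ v w + outdeg G w * unit v w ≡ σ w + inflow (unit v) w
    by-cases (yes refl) = begin
      fire G σ v v + outdeg G v * unit v v         ≡⟨ cong₂ (λ a k → a + outdeg G v * k) (fire-self σ v) (unit-diag v) ⟩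
      (σ v ∸ outdeg G v) + G v v + outdeg G v * 1  ≡⟨ rearrange (σ v ∸ outdeg G v) (G v v) (outdeg G v) ⟩
      (σ v ∸ outdeg G v) + outdeg G v + G v v      ≡⟨ cong₂ _+_ (m∸n+n≡m fv) (sym (inflow-unit v v)) ⟩
      σ v + inflow (unit v) v                      ∎
    by-cases (no w≢v) = begin
      fire G σ v w + outdeg G w * unit v w  ≡⟨ cong₂ (λ a k → a + outdeg G w * k) (fire-other σ w≢v) (unit-off w≢v) ⟩
      σ w + G v w + outdeg G w * 0          ≡⟨ cong (σ w + G v w +_) (*-zeroʳ (outdeg G w)) ⟩
      σ w + G v w + 0                       ≡⟨ +-identityʳ (σ w + G v w) ⟩
      σ w + G v w                           ≡⟨ cong (σ w +_) (sym (inflow-unit v w)) ⟩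
      σ w + inflow (unit v) w               ∎

  balanced-trans : ∀ {σ τ ρ c c'} → Balanced σ c τ → Balanced τ c' ρ → Balanced σ (c +̇ c') ρ
  balanced-trans {σ} {τ} {ρ} {c} {c'} bc bc' w = begin
    ρ w + d * (c w + c' w)            ≡⟨ distrib-swap (ρ w) d (c w) (c' w) ⟩
    (ρ w + d * c' w) + d * c w        ≡⟨ cong (_+ d * c w) (bc' w) ⟩
    (τ w + inflow c' w) + d * c w     ≡⟨ swap (τ w) (inflow c' w) (d * c w) ⟩
    (τ w + d * c w) + inflow c' w     ≡⟨ cong (_+ inflow c' w) (bc w) ⟩
    σ w + inflow c w + inflow c' w    ≡⟨ +-assoc (σ w) (inflow c w) (inflow c' w) ⟩
    σ w + (inflow c w + inflow c' w)  ≡⟨ cong (σ w +_) (sym (inflow-+̇ c c' w)) ⟩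
    σ w + inflow (c +̇ c') w           ∎
    where
    open ≡-Reasoning
    d = outdeg G w
    distrib-swap : ∀ r k a b → r + k * (a + b) ≡ (r + k * b) + k * a
    distrib-swap = solve-∀
    swap : ∀ a b e → a + b + e ≡ a + e + b
    swap = solve-∀

  balanced-step : ∀ {σ τ} (s : Step G σ τ) → Balanced σ (unit (proj₁ s)) τ
  balanced-step {σ} (v , fv , τ≗fire) w = trans (cong (_+ outdeg G w * unit v w) (τ≗fire w)) (balanced-fire σ v fv w)

  balanced-+shots : ∀ {σ τ ρ c} → Balanced σ c τ → (p : Reach G τ ρ) → Balanced σ (c +shots p) ρ
  balanced-+shots bc ε = bc
  balanced-+shots bc (s ◅ p) = balanced-+shots (balanced-trans bc (balanced-step s)) p

  balanced-shots : ∀ {σ τ} (p : Reach G σ τ) → Balanced σ (shots p) τ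
  balanced-shots {σ} = balanced-+shots (balanced-refl σ)

  balanced-unique : ∀ {σ τ τ' c c'} → Balanced σ c τ → Balanced σ c' τ' → c ≗ c' → τ ≗ τ'
  balanced-unique {σ} {τ} {τ'} {c} {c'} bc bc' c≗c' w = +-cancelʳ-≡ (outdeg G w * c w) (τ w) (τ' w) (begin
    τ w + outdeg G w * c w    ≡⟨ bc w ⟩
    σ w + inflow c w          ≡⟨ cong (σ w +_) (sum-cong-≗ (λ u → cong (G u w *_) (c≗c' u))) ⟩
    σ w + inflow c' w         ≡⟨ sym (bc' w) ⟩
    τ' w + outdeg G w * c' w  ≡⟨ cong (λ k → τ' w + outdeg G w * k) (sym (c≗c' w)) ⟩
    τ' w + outdeg G w * c w   ∎)
    where open ≡-Reasoning

  -- At the first firing of a vertex v with c v = m v, the two balance equations give τ v ≤ ζ v,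
  -- so v is firable at ζ and K v ≤ m v = c v: that firing would break the budget K.
  least-action : ∀ {σ m ζ} K → Balanced σ m ζ → (∀ v → outdeg G v ≤ ζ v → K v ≤ m v) →
                 ∀ {c τ τ'} → Balanced σ c τ → c ≤̇ m → (p : Reach G τ τ') → c +shots p ≤̇ K → c +shots p ≤̇ m
  least-action K bm saturated bc c≤m ε _ = c≤m
  least-action {σ} {m} {ζ} K bm saturated {c} {τ} bc c≤m (s@(v , fv , _) ◅ p) c+p≤K =
    least-action K bm saturated (balanced-trans bc (balanced-step s)) (+̇unit-≤̇ v c≤m cv<mv) p c+p≤K
    where
    m<K : c v ≡ m v → m v < K v
    m<K cv≡mv = begin-strict
      m v                        ≡⟨ sym cv≡mv ⟩
      c v                        <⟨ m<m+n (c v) (≤-reflexive (sym (unit-diag v))) ⟩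
      c v + unit v v             ≤⟨ +shots-≥ (c +̇ unit v) p v ⟩
      ((c +̇ unit v) +shots p) v  ≤⟨ c+p≤K v ⟩
      K v                        ∎
      where open ≤-Reasoning
    τ≤ζ : c v ≡ m v → τ v ≤ ζ v
    τ≤ζ cv≡mv = +-cancelʳ-≤ (outdeg G v * c v) (τ v) (ζ v) (begin
      τ v + outdeg G v * c v  ≡⟨ bc v ⟩
      σ v + inflow c v        ≤⟨ +-monoʳ-≤ (σ v) (inflow-mono c≤m v) ⟩
      σ v + inflow m v        ≡⟨ sym (bm v) ⟩
      ζ v + outdeg G v * m v  ≡⟨ cong (λ k → ζ v + outdeg G v * k) (sym cv≡mv) ⟩
      ζ v + outdeg G v * c v  ∎)
      where open ≤-Reasoning
    cv<mv : c v < m v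
    cv<mv with m≤n⇒m<n∨m≡n (c≤m v)
    ... | inj₁ cv<mv = cv<mv
    ... | inj₂ cv≡mv = contradiction (saturated v (≤-trans fv (τ≤ζ cv≡mv))) (<⇒≱ (m<K cv≡mv))

  least-action-terminal : ∀ {σ m ζ} → Balanced σ m ζ → Terminal ζ →
                          ∀ {c τ τ'} → Balanced σ c τ → c ≤̇ m → (p : Reach G τ τ') → c +shots p ≤̇ m
  least-action-terminal bm ζ-terminal {c} bc c≤m p =
    least-action (c +shots p) bm (λ v fv → contradiction fv (<⇒≱ (ζ-terminal v))) bc c≤m p (λ _ → ≤-refl)

  saturate : ∀ K {σ c} → Convergent G σ → c ≤̇ K →
             ∃[ τ ] Σ (Reach G σ τ) λ q → c +shots q ≤̇ K × (∀ v → outdeg G v ≤ τ v → K v ≤ (c +shots q) v)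
  saturate K {σ} {c} (acc rs) c≤K with Fin.any? (λ v → (c v <? K v) ×-dec (outdeg G v ≤? σ v))
  ... | yes (v , cv<Kv , fv) with saturate K (rs (v , fv , λ _ → refl)) (+̇unit-≤̇ v c≤K cv<Kv)
  ...   | τ , q , bounded , saturated = τ , (v , fv , λ _ → refl) ◅ q , bounded , saturated
  saturate K {σ} {c} (acc rs) c≤K | no none = σ , ε , c≤K , λ v fv → ≮⇒≥ (λ cv<Kv → none (v , cv<Kv , fv))

  shots-unique : ∀ {σ τ τ'} → Convergent G σ → (p : Reach G σ τ) (p' : Reach G σ τ') → τ ≗ τ' → shots p ≗ shots p'
  shots-unique {σ} {τ} {τ'} σ↓ p p' τ≗τ' w with stabilise (convergent-after σ↓ p)
  ... | ζ , q , ζ-terminal = +-cancelʳ-≡ (shots q w) (shots p w) (shots p' w) (begin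
    shots p w + shots q w   ≡⟨ sym (+shots-split (shots p) q w) ⟩
    (shots p +shots q) w    ≡⟨ ≤-antisym (dominated p b (balanced-+shots b' q) w) (dominated p' b' (balanced-+shots b q) w) ⟩
    (shots p' +shots q) w   ≡⟨ +shots-split (shots p') q w ⟩
    shots p' w + shots q w  ∎)
    where
    open ≡-Reasoning
    b : Balanced σ (shots p) τ
    b = balanced-shots p
    b' : Balanced σ (shots p') τ
    b' w = trans (cong (_+ outdeg G w * shots p' w) (τ≗τ' w)) (balanced-shots p' w)
    dominated : ∀ {τ₁ m} (p₁ : Reach G σ τ₁) → Balanced σ (shots p₁) τ → Balanced σ m ζ → shots p₁ +shots q ≤̇ m
    dominated p₁ b₁ bm = least-action-terminal bm ζ-terminal b₁
      (least-action-terminal bm ζ-terminal (balanced-refl σ) (λ _ → z≤n) p₁) q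

  dominated-play-extends : ∀ {σ τ β} → Convergent G σ → (p* : Reach G σ β) (p : Reach G σ τ) → shots p ≤̇ shots p* →
                           ∃[ β' ] Reach G τ β' × β' ≗ β
  dominated-play-extends {σ} σ↓ p* p p≤p* with saturate (shots p*) (convergent-after σ↓ p) p≤p*
  ... | β' , q , bounded , saturated = β' , q , balanced-unique bpq (balanced-shots p*) (λ w → ≤-antisym (bounded w) (p*≤pq w))
    where
    bpq : Balanced σ (shots p +shots q) β'
    bpq = balanced-+shots (balanced-shots p) q
    p*≤pq : shots p* ≤̇ shots p +shots q
    p*≤pq = least-action (shots p*) bpq saturated (balanced-refl σ) (λ _ → z≤n) p* (λ _ → ≤-refl)

module CopyChips (N : ℕ) where

  -- For c, i ≤ N, gap c i is the residue of c − 1 − i modulo N + 1.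
  gap : ℕ → ℕ → ℕ
  gap c i with i <? c
  ... | yes _ = c ∸ suc i
  ... | no _ = (N ∸ i) + c

  gap-self : ∀ {c} → c ≤ N → gap c c ≡ N
  gap-self {c} c≤N with c <? c
  ... | yes c<c = contradiction c<c (<-irrefl refl)
  ... | no _ = m∸n+n≡m c≤N

  gap-≤ : ∀ {c i} → c ≤ N → i ≤ N → gap c i ≤ N
  gap-≤ {c} {i} c≤N i≤N with i <? c
  ... | yes _ = ≤-trans (m∸n≤m c (suc i)) c≤N
  ... | no i≮c = ≤-trans (+-monoˡ-≤ c (∸-monoʳ-≤ N (≮⇒≥ i≮c))) (≤-reflexive (m∸n+n≡m c≤N))

  gap-fired : ∀ c → gap (suc c) c ≡ 0
  gap-fired c with c <? suc c
  ... | yes _ = n∸n≡0 c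
  ... | no c≮1+c = contradiction (n<1+n c) c≮1+c

  gap-suc : ∀ {c i} → i ≢ c → gap (suc c) i ≡ suc (gap c i)
  gap-suc {c} {i} i≢c with i <? suc c | i <? c
  ... | yes _ | yes i<c = +-∸-assoc 1 i<c
  ... | yes i<1+c | no i≮c = contradiction (≤-antisym (s≤s⁻¹ i<1+c) (≮⇒≥ i≮c)) i≢c
  ... | no i≮1+c | yes i<c = contradiction (m<n⇒m<1+n i<c) i≮1+c
  ... | no _ | no _ = +-suc (N ∸ i) c

  chips : (d R y c i : ℕ) → ℕ
  chips d R y c i = y + d * gap c i + δ i c * R

  chips-current : ∀ d R y {c} → c ≤ N → chips d R y c c ≡ y + (d * N + R)
  chips-current d R y {c} c≤N = begin
    y + d * gap c c + δ c c * R  ≡⟨ cong₂ (λ g e → y + d * g + e * R) (gap-self c≤N) (δ-diag c) ⟩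
    y + d * N + 1 * R            ≡⟨ cong (y + d * N +_) (*-identityˡ R) ⟩
    y + d * N + R                ≡⟨ +-assoc y (d * N) R ⟩
    y + (d * N + R)              ∎
    where open ≡-Reasoning

  chips-other : ∀ d R {y c i} → y < R → c ≤ N → i ≤ N → i ≢ c → chips d R y c i < d * N + R
  chips-other d R {y} {c} {i} y<R c≤N i≤N i≢c = begin-strict
    y + d * gap c i + δ i c * R  ≡⟨ cong (λ e → y + d * gap c i + e * R) (δ-off i≢c) ⟩
    y + d * gap c i + 0          ≡⟨ +-identityʳ (y + d * gap c i) ⟩
    y + d * gap c i              <⟨ +-monoˡ-< (d * gap c i) y<R ⟩
    R + d * gap c i              ≤⟨ +-monoʳ-≤ R (*-monoʳ-≤ d (gap-≤ c≤N i≤N)) ⟩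
    R + d * N                    ≡⟨ +-comm R (d * N) ⟩
    d * N + R                    ∎
    where open ≤-Reasoning

  chips-spent : ∀ d R y c → chips d R y (suc c) c ≡ y
  chips-spent d R y c = begin
    y + d * gap (suc c) c + δ c (suc c) * R  ≡⟨ cong₂ (λ g k → y + d * g + k * R) (gap-fired c) (δ-off {c} (1+n≢n ∘ sym)) ⟩
    y + d * 0 + 0                            ≡⟨ +-identityʳ (y + d * 0) ⟩
    y + d * 0                                ≡⟨ cong (y +_) (*-zeroʳ d) ⟩
    y + 0                                    ≡⟨ +-identityʳ y ⟩
    y                                        ∎
    where open ≡-Reasoning

  chips-fired : ∀ d R y e {c} → c ≤ N → (chips d R y c c ∸ (d + (d * N + R))) + e ≡ chips d R ((y ∸ d) + e) (suc c) c
  chips-fired d R y e {c} c≤N = begin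
    (chips d R y c c ∸ (d + T)) + e    ≡⟨ cong (λ k → (k ∸ (d + T)) + e) (chips-current d R y c≤N) ⟩
    ((y + T) ∸ (d + T)) + e            ≡⟨ cong₂ (λ a b → (a ∸ b) + e) (+-comm y T) (+-comm d T) ⟩
    ((T + y) ∸ (T + d)) + e            ≡⟨ cong (_+ e) ([m+n]∸[m+o]≡n∸o T y d) ⟩
    (y ∸ d) + e                        ≡⟨ sym (chips-spent d R ((y ∸ d) + e) c) ⟩
    chips d R ((y ∸ d) + e) (suc c) c  ∎
    where
    open ≡-Reasoning
    T = d * N + R

  chips-sibling : ∀ d R {y} e {c i} → d ≤ y → i ≢ c →
                  chips d R y c i + (e + δ i (suc c) * R) ≡ chips d R ((y ∸ d) + e) (suc c) i
  chips-sibling d R {y} e {c} {i} d≤y i≢c = begin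
    y + d * gap c i + δ i c * R + (e + r)
      ≡⟨ cong₂ (λ a k → a + d * gap c i + k * R + (e + r)) (sym (m∸n+n≡m d≤y)) (δ-off i≢c) ⟩
    (y ∸ d) + d + d * gap c i + 0 + (e + r)
      ≡⟨ rearrange (y ∸ d) d (gap c i) e r ⟩
    (y ∸ d) + e + d * suc (gap c i) + r
      ≡⟨ cong (λ g → (y ∸ d) + e + d * g + r) (sym (gap-suc i≢c)) ⟩
    (y ∸ d) + e + d * gap (suc c) i + r      ∎
    where
    open ≡-Reasoning
    r = δ i (suc c) * R
    rearrange : ∀ t d g e r → t + d + d * g + 0 + (e + r) ≡ t + e + d * suc g + r
    rearrange = solve-∀

  chips-neighbour : ∀ d R y e c i → chips d R y c i + e ≡ chips d R (y + e) c i
  chips-neighbour d R y e c i = rearrange y (d * gap c i) (δ i c * R) e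
    where
    rearrange : ∀ y a b e → y + a + b + e ≡ y + e + a + b
    rearrange = solve-∀

-- The game G′ plays G from α under the firing budget K. Vertex v of G becomes the copies
-- (v , j) = combine v j, j ≤ N. After G has
-- fired the shot vector c and holds y, the configuration Ψ c puts y w + d w · gap (c w) i chips
-- on (w , i), plus R w on the copy (w , c w) due to fire next. The other copies hold less than
-- T w, while (w , c w) holds y w + T w, so it is firable (out-degree D w = d w + T w) exactly
-- when it is live and w is firable in G; and firing it is firing w.
module Budgeted {n : ℕ} (G : Multigraph n) (α : Config n) (K : Fin n → ℕ) where
  open Game G

  N : ℕ
  N = ∑[ w < n ] K w

  M : ℕ
  M = suc N

  K≤N : ∀ w → K w ≤ N
  K≤N = term≤∑ K

  open CopyChips N

  d : Fin n → ℕ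
  d = outdeg G

  R T D : Fin n → ℕ
  R w = suc (α w + inflow K w)
  T w = d w * N + R w
  D w = d w + T w

  chipsOn : Fin n → (y c i : ℕ) → ℕ
  chipsOn w = chips (d w) (R w)

  edges : Fin n → Fin M → Fin n → Fin M → ℕ
  edges v j w i with toℕ j <? K v
  ... | yes _ = G v w + unit v w * (δ (toℕ i) (suc (toℕ j)) * R v)
  ... | no _ = unit v w * (δ (toℕ i) (toℕ j) * (D v + R v))

  edges-live : ∀ {v j} w i → toℕ j < K v → edges v j w i ≡ G v w + unit v w * (δ (toℕ i) (suc (toℕ j)) * R v)
  edges-live {v} {j} w i live with toℕ j <? K v
  ... | yes _ = refl
  ... | no dead = contradiction live dead

  edges-dead : ∀ {v j} w i → ¬ toℕ j < K v → edges v j w i ≡ unit v w * (δ (toℕ i) (toℕ j) * (D v + R v))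
  edges-dead {v} {j} w i dead with toℕ j <? K v
  ... | yes live = contradiction live dead
  ... | no _ = refl

  G′ : Multigraph (n * M)
  G′ p q = uncurry (uncurry edges (remQuot M p)) (remQuot M q)

  module G′ = Game G′

  ∀-combine : ∀ (P : Fin (n * M) → Set) → (∀ (w : Fin n) (i : Fin M) → P (combine w i)) → ∀ q → P q
  ∀-combine P P-combine q = subst P (Fin.combine-remQuot {n} M q) (uncurry P-combine (remQuot M q))

  G′-combine : ∀ v j w i → G′ (combine v j) (combine w i) ≡ edges v j w i
  G′-combine v j w i = cong₂ (λ a b → uncurry (uncurry edges a) b) (Fin.remQuot-combine v j) (Fin.remQuot-combine w i)

  outdeg-copy : ∀ v j → outdeg G′ (combine v j) ≡ ∑[ w < n ] ∑[ i < M ] edges v j w i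
  outdeg-copy v j = begin
    outdeg G′ (combine v j)                               ≡⟨ sum-map-allFin (G′ (combine v j)) ⟩
    ∑[ q < n * M ] G′ (combine v j) q                     ≡⟨ ∑-combine n M (G′ (combine v j)) ⟩
    ∑[ w < n ] ∑[ i < M ] G′ (combine v j) (combine w i)  ≡⟨ sum-cong-≗ (λ w → sum-cong-≗ (G′-combine v j w)) ⟩
    ∑[ w < n ] ∑[ i < M ] edges v j w i                   ∎
    where open ≡-Reasoning

  outdeg-live : ∀ {v j} → toℕ j < K v → outdeg G′ (combine v j) ≡ D v
  outdeg-live {v} {j} live = begin
    outdeg G′ (combine v j)                  ≡⟨ outdeg-copy v j ⟩
    ∑[ w < n ] ∑[ i < M ] edges v j w i     ≡⟨ sum-cong-≗ (λ w → sum-cong-≗ (λ i → edges-live w i live)) ⟩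
    ∑[ w < n ] ∑[ i < M ] (G v w + unit v w * (δ (toℕ i) (suc (toℕ j)) * R v))
                                             ≡⟨ sum-cong-≗ per-target ⟩
    ∑[ w < n ] (M * G v w + unit v w * R v)  ≡⟨ ∑-distrib-+ {n} (λ w → M * G v w) (λ w → unit v w * R v) ⟩
    ∑[ w < n ] (M * G v w) + ∑[ w < n ] (unit v w * R v)
                                             ≡⟨ cong₂ _+_ (sym (*-distribˡ-sum {n} M (G v))) (∑-δ v (λ _ → R v)) ⟩
    M * ∑[ w < n ] G v w + R v               ≡⟨ cong (λ k → M * k + R v) (sym (sum-map-allFin (G v))) ⟩
    M * d v + R v                            ≡⟨ rearrange N (d v) (R v) ⟩
    D v                                      ∎
    where
    open ≡-Reasoning
    next<M : suc (toℕ j) < M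
    next<M = s≤s (≤-trans live (K≤N v))
    per-target : ∀ w → ∑[ i < M ] (G v w + unit v w * (δ (toℕ i) (suc (toℕ j)) * R v)) ≡ M * G v w + unit v w * R v
    per-target w = begin
      ∑[ i < M ] (G v w + unit v w * (δ (toℕ i) (suc (toℕ j)) * R v))
        ≡⟨ ∑-distrib-+ {M} (λ _ → G v w) (λ i → unit v w * (δ (toℕ i) (suc (toℕ j)) * R v)) ⟩
      ∑[ i < M ] G v w + ∑[ i < M ] (unit v w * (δ (toℕ i) (suc (toℕ j)) * R v))
        ≡⟨ cong₂ _+_ (∑-const M (G v w)) (sym (*-distribˡ-sum {M} (unit v w) (λ i → δ (toℕ i) (suc (toℕ j)) * R v))) ⟩
      M * G v w + unit v w * ∑[ i < M ] (δ (toℕ i) (suc (toℕ j)) * R v)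
        ≡⟨ cong (λ k → M * G v w + unit v w * k) (∑-δ′ {M} next<M (R v)) ⟩
      M * G v w + unit v w * R v ∎
    rearrange : ∀ N d R → suc N * d + R ≡ d + (d * N + R)
    rearrange = solve-∀

  outdeg-dead : ∀ {v j} → ¬ toℕ j < K v → outdeg G′ (combine v j) ≡ D v + R v
  outdeg-dead {v} {j} dead = begin
    outdeg G′ (combine v j)
      ≡⟨ outdeg-copy v j ⟩
    ∑[ w < n ] ∑[ i < M ] edges v j w i
      ≡⟨ sum-cong-≗ (λ w → sum-cong-≗ (λ i → edges-dead w i dead)) ⟩
    ∑[ w < n ] ∑[ i < M ] (unit v w * (δ (toℕ i) (toℕ j) * (D v + R v)))
      ≡⟨ sum-cong-≗ per-target ⟩
    ∑[ w < n ] (unit v w * (D v + R v))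
      ≡⟨ ∑-δ v (λ _ → D v + R v) ⟩
    D v + R v ∎
    where
    open ≡-Reasoning
    per-target : ∀ w → ∑[ i < M ] (unit v w * (δ (toℕ i) (toℕ j) * (D v + R v))) ≡ unit v w * (D v + R v)
    per-target w = trans (sym (*-distribˡ-sum {M} (unit v w) (λ i → δ (toℕ i) (toℕ j) * (D v + R v))))
                         (cong (unit v w *_) (∑-δ′ {M} (Fin.toℕ<n j) (D v + R v)))

  D≤outdeg : ∀ v j → D v ≤ outdeg G′ (combine v j)
  D≤outdeg v j with toℕ j <? K v
  ... | yes live = ≤-reflexive (sym (outdeg-live live))
  ... | no dead = ≤-trans (m≤m+n (D v) (R v)) (≤-reflexive (sym (outdeg-dead dead)))

  residual : (Fin n → ℕ) → Config n
  residual c w = (α w + inflow c w) ∸ d w * c w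

  residual-balanced : ∀ {c y} → Balanced α c y → residual c ≗ y
  residual-balanced {c} {y} bc w = trans (cong (_∸ d w * c w) (sym (bc w))) (m+n∸n≡m (y w) (d w * c w))

  residual<R : ∀ {c} → c ≤̇ K → ∀ w → residual c w < R w
  residual<R {c} c≤K w = s≤s (≤-trans (m∸n≤m _ (d w * c w)) (+-monoʳ-≤ (α w) (inflow-mono c≤K w)))

  -- Reading c through a vector makes Ψ send pointwise equal shot vectors to equal configurations;
  -- this is what lets an empty play of G lift to the empty play of G′.
  canon : (Fin n → ℕ) → Fin n → ℕ
  canon c = lookup (tabulateᵛ c)

  copyChips : (Fin n → ℕ) → Fin n → Fin M → ℕ
  copyChips c w i = chipsOn w (residual c w) (c w) (toℕ i)

  Ψ : (Fin n → ℕ) → Config (n * M)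
  Ψ c p = uncurry (copyChips (canon c)) (remQuot M p)

  Ψ-cong : ∀ {c c'} → c ≗ c' → Ψ c ≡ Ψ c'
  Ψ-cong c≗c' = cong (λ c̃ p → uncurry (copyChips (lookup c̃)) (remQuot M p)) (Vec.tabulate-cong c≗c')

  Ψ-combine : ∀ c w i → Ψ c (combine w i) ≡ copyChips c w i
  Ψ-combine c w i = trans (cong (uncurry (copyChips (canon c))) (Fin.remQuot-combine w i))
                          (cong₂ (λ r k → chipsOn w r k (toℕ i)) residual-canon (canon≗ w))
    where
    canon≗ : canon c ≗ c
    canon≗ = Vec.lookup∘tabulate c
    residual-canon : residual (canon c) w ≡ residual c w
    residual-canon = cong₂ (λ a b → (α w + a) ∸ d w * b) (sum-cong-≗ (λ u → cong (G u w *_) (canon≗ u))) (canon≗ w)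

  Ψ-balanced : ∀ {c y} → Balanced α c y → ∀ w i → Ψ c (combine w i) ≡ chipsOn w (y w) (c w) (toℕ i)
  Ψ-balanced {c} bc w i = trans (Ψ-combine c w i) (cong (λ r → chipsOn w r (c w) (toℕ i)) (residual-balanced bc w))

  Ψ-current : ∀ {c} → c ≤̇ K → ∀ {w i} → toℕ i ≡ c w → Ψ c (combine w i) ≡ residual c w + T w
  Ψ-current {c} c≤K {w} {i} i≡cw = begin
    Ψ c (combine w i)                         ≡⟨ Ψ-combine c w i ⟩
    chipsOn w (residual c w) (c w) (toℕ i)    ≡⟨ cong (chipsOn w (residual c w) (c w)) i≡cw ⟩
    chipsOn w (residual c w) (c w) (c w)      ≡⟨ chips-current (d w) (R w) (residual c w) (≤-trans (c≤K w) (K≤N w)) ⟩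
    residual c w + T w                        ∎
    where open ≡-Reasoning

  Ψ-other : ∀ {c} → c ≤̇ K → ∀ {w i} → toℕ i ≢ c w → Ψ c (combine w i) < T w
  Ψ-other {c} c≤K {w} {i} i≢cw = subst (_< T w) (sym (Ψ-combine c w i))
    (chips-other (d w) (R w) (residual<R c≤K w) (≤-trans (c≤K w) (K≤N w)) (s≤s⁻¹ (Fin.toℕ<n i)) i≢cw)

  Ψ-injective : ∀ {c c'} → c ≤̇ K → c' ≤̇ K → Ψ c ≗ Ψ c' → c ≗ c'
  Ψ-injective {c} {c'} c≤K c'≤K Ψc≗Ψc' w =
    ≤-antisym (≮⇒≥ (not-below c'≤K c≤K (sym ∘ Ψc≗Ψc'))) (≮⇒≥ (not-below c≤K c'≤K Ψc≗Ψc'))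
    where
    not-below : ∀ {c c'} → c ≤̇ K → c' ≤̇ K → Ψ c ≗ Ψ c' → ¬ c w < c' w
    not-below {c} {c'} c≤K c'≤K Ψc≗Ψc' cw<c'w =
      <⇒≱ (Ψ-other c'≤K {w} {i} (<⇒≢ (subst (_< c' w) (sym i≡cw) cw<c'w))) (begin
        T w                 ≤⟨ m≤n+m (T w) (residual c w) ⟩
        residual c w + T w  ≡⟨ sym (Ψ-current c≤K i≡cw) ⟩
        Ψ c (combine w i)   ≡⟨ Ψc≗Ψc' (combine w i) ⟩
        Ψ c' (combine w i)  ∎)
      where
      open ≤-Reasoning
      cw<M : c w < M
      cw<M = s≤s (≤-trans (c≤K w) (K≤N w))
      i = fromℕ< cw<M
      i≡cw : toℕ i ≡ c w
      i≡cw = Fin.toℕ-fromℕ< cw<M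

  fire-copy-neighbour : ∀ {c y v j w} i → Balanced α c y → toℕ j < K v → d v ≤ y v → w ≢ v →
                        fire G′ (Ψ c) (combine v j) (combine w i) ≡ Ψ (c +̇ unit v) (combine w i)
  fire-copy-neighbour {c} {y} {v} {j} {w} i bc live fv w≢v = begin
    fire G′ (Ψ c) (combine v j) (combine w i)
      ≡⟨ G′.fire-other (Ψ c) (w≢v ∘ Fin.combine-injectiveˡ w i v j) ⟩
    Ψ c (combine w i) + G′ (combine v j) (combine w i)
      ≡⟨ cong₂ _+_ (Ψ-balanced bc w i) (trans (G′-combine v j w i) (edges-live w i live)) ⟩
    chipsOn w (y w) (c w) (toℕ i) + (G v w + unit v w * (δ (toℕ i) (suc (toℕ j)) * R v))
      ≡⟨ cong (λ k → chipsOn w (y w) (c w) (toℕ i) + (G v w + k * (δ (toℕ i) (suc (toℕ j)) * R v))) (unit-off w≢v) ⟩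
    chipsOn w (y w) (c w) (toℕ i) + (G v w + 0)
      ≡⟨ cong (chipsOn w (y w) (c w) (toℕ i) +_) (+-identityʳ (G v w)) ⟩
    chipsOn w (y w) (c w) (toℕ i) + G v w
      ≡⟨ chips-neighbour (d w) (R w) (y w) (G v w) (c w) (toℕ i) ⟩
    chipsOn w (y w + G v w) (c w) (toℕ i)
      ≡⟨ cong₂ (λ a k → chipsOn w a k (toℕ i)) (sym (fire-other y w≢v)) (sym (+̇unit-other c w≢v)) ⟩
    chipsOn w (fire G y v w) ((c +̇ unit v) w) (toℕ i)
      ≡⟨ sym (Ψ-balanced (balanced-trans bc (balanced-fire y v fv)) w i) ⟩
    Ψ (c +̇ unit v) (combine w i) ∎
    where open ≡-Reasoning

  fire-copy-sibling : ∀ {c y v j} i → Balanced α c y → toℕ j ≡ c v → toℕ j < K v → d v ≤ y v → i ≢ j →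
                      fire G′ (Ψ c) (combine v j) (combine v i) ≡ Ψ (c +̇ unit v) (combine v i)
  fire-copy-sibling {c} {y} {v} {j} i bc j≡cv live fv i≢j = begin
    fire G′ (Ψ c) (combine v j) (combine v i)
      ≡⟨ G′.fire-other (Ψ c) (i≢j ∘ Fin.combine-injectiveʳ v i v j) ⟩
    Ψ c (combine v i) + G′ (combine v j) (combine v i)
      ≡⟨ cong₂ _+_ (Ψ-balanced bc v i) (trans (G′-combine v j v i) (edges-live v i live)) ⟩
    chipsOn v (y v) (c v) (toℕ i) + (G v v + unit v v * (δ (toℕ i) (suc (toℕ j)) * R v))
      ≡⟨ cong₂ (λ u k → chipsOn v (y v) (c v) (toℕ i) + (G v v + u * (δ (toℕ i) (suc k) * R v))) (unit-diag v) j≡cv ⟩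
    chipsOn v (y v) (c v) (toℕ i) + (G v v + 1 * (δ (toℕ i) (suc (c v)) * R v))
      ≡⟨ cong (λ k → chipsOn v (y v) (c v) (toℕ i) + (G v v + k)) (*-identityˡ (δ (toℕ i) (suc (c v)) * R v)) ⟩
    chipsOn v (y v) (c v) (toℕ i) + (G v v + δ (toℕ i) (suc (c v)) * R v)
      ≡⟨ chips-sibling (d v) (R v) (G v v) fv i≢cv ⟩
    chipsOn v ((y v ∸ d v) + G v v) (suc (c v)) (toℕ i)
      ≡⟨ cong₂ (λ a k → chipsOn v a k (toℕ i)) (sym (fire-self y v)) (sym (+̇unit-self c v)) ⟩
    chipsOn v (fire G y v v) ((c +̇ unit v) v) (toℕ i)
      ≡⟨ sym (Ψ-balanced (balanced-trans bc (balanced-fire y v fv)) v i) ⟩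
    Ψ (c +̇ unit v) (combine v i) ∎
    where
    open ≡-Reasoning
    i≢cv : toℕ i ≢ c v
    i≢cv i≡cv = i≢j (Fin.toℕ-injective (trans i≡cv (sym j≡cv)))

  fire-copy-self : ∀ {c y v j} → c v ≤ N → Balanced α c y → toℕ j ≡ c v → toℕ j < K v → d v ≤ y v →
                   fire G′ (Ψ c) (combine v j) (combine v j) ≡ Ψ (c +̇ unit v) (combine v j)
  fire-copy-self {c} {y} {v} {j} cv≤N bc j≡cv live fv = begin
    fire G′ (Ψ c) p p
      ≡⟨ G′.fire-self (Ψ c) p ⟩
    (Ψ c p ∸ outdeg G′ p) + G′ p p
      ≡⟨ cong₂ (λ a b → (a ∸ b) + G′ p p) (Ψ-balanced bc v j) (outdeg-live live) ⟩
    (chipsOn v (y v) (c v) (toℕ j) ∸ D v) + G′ p p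
      ≡⟨ cong₂ (λ k e → (chipsOn v (y v) (c v) k ∸ D v) + e) j≡cv no-loop-to-successor ⟩
    (chipsOn v (y v) (c v) (c v) ∸ D v) + G v v
      ≡⟨ chips-fired (d v) (R v) (y v) (G v v) cv≤N ⟩
    chipsOn v ((y v ∸ d v) + G v v) (suc (c v)) (c v)
      ≡⟨ cong₃ (sym (fire-self y v)) (sym (+̇unit-self c v)) (sym j≡cv) ⟩
    chipsOn v (fire G y v v) ((c +̇ unit v) v) (toℕ j)
      ≡⟨ sym (Ψ-balanced (balanced-trans bc (balanced-fire y v fv)) v j) ⟩
    Ψ (c +̇ unit v) p ∎
    where
    open ≡-Reasoning
    p = combine v j
    cong₃ : ∀ {a a' k k' l l'} → a ≡ a' → k ≡ k' → l ≡ l' → chipsOn v a k l ≡ chipsOn v a' k' l'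
    cong₃ refl refl refl = refl
    no-loop-to-successor : G′ p p ≡ G v v
    no-loop-to-successor = begin
      G′ p p
        ≡⟨ trans (G′-combine v j v j) (edges-live v j live) ⟩
      G v v + unit v v * (δ (toℕ j) (suc (toℕ j)) * R v)
        ≡⟨ cong (λ k → G v v + unit v v * (k * R v)) (δ-off {toℕ j} (1+n≢n ∘ sym)) ⟩
      G v v + unit v v * 0
        ≡⟨ cong (G v v +_) (*-zeroʳ (unit v v)) ⟩
      G v v + 0
        ≡⟨ +-identityʳ (G v v) ⟩
      G v v ∎

  fire-copy : ∀ {c y v j} → c ≤̇ K → Balanced α c y → toℕ j ≡ c v → c v < K v → d v ≤ y v →
              fire G′ (Ψ c) (combine v j) ≗ Ψ (c +̇ unit v)
  fire-copy {c} {y} {v} {j} c≤K bc j≡cv cv<Kv fv = ∀-combine (λ q → fire G′ (Ψ c) (combine v j) q ≡ Ψ (c +̇ unit v) q) at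
    where
    live : toℕ j < K v
    live = subst (_< K v) (sym j≡cv) cv<Kv
    at : ∀ w i → fire G′ (Ψ c) (combine v j) (combine w i) ≡ Ψ (c +̇ unit v) (combine w i)
    at w i with w ≟ v | i ≟ j
    ... | no w≢v | _ = fire-copy-neighbour i bc live fv w≢v
    ... | yes refl | no i≢j = fire-copy-sibling i bc j≡cv live fv i≢j
    ... | yes refl | yes refl = fire-copy-self (≤-trans (c≤K v) (K≤N v)) bc j≡cv live fv

  current-copy-firable : ∀ {c y v j} → c ≤̇ K → Balanced α c y → toℕ j ≡ c v → c v < K v → d v ≤ y v →
                         outdeg G′ (combine v j) ≤ Ψ c (combine v j)
  current-copy-firable {c} {y} {v} {j} c≤K bc j≡cv cv<Kv fv = begin
    outdeg G′ (combine v j)  ≡⟨ outdeg-live (subst (_< K v) (sym j≡cv) cv<Kv) ⟩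
    d v + T v                ≤⟨ +-monoˡ-≤ (T v) (subst (d v ≤_) (sym (residual-balanced bc v)) fv) ⟩
    residual c v + T v       ≡⟨ sym (Ψ-current c≤K j≡cv) ⟩
    Ψ c (combine v j)        ∎
    where open ≤-Reasoning

  firable-copy-current : ∀ {c y v j} → c ≤̇ K → Balanced α c y → outdeg G′ (combine v j) ≤ Ψ c (combine v j) →
                         toℕ j ≡ c v × c v < K v × d v ≤ y v
  firable-copy-current {c} {y} {v} {j} c≤K bc firable with toℕ j ≟ℕ c v
  ... | no j≢cv = contradiction (≤-trans (≤-trans (m≤n+m (T v) (d v)) (D≤outdeg v j)) firable) (<⇒≱ (Ψ-other c≤K j≢cv))
  ... | yes j≡cv with toℕ j <? K v
  ...   | no dead = contradiction firable (<⇒≱ (begin-strict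
          Ψ c (combine v j)        ≡⟨ Ψ-current c≤K j≡cv ⟩
          residual c v + T v       <⟨ +-monoˡ-< (T v) (residual<R c≤K v) ⟩
          R v + T v                ≤⟨ m≤n+m (R v + T v) (d v) ⟩
          d v + (R v + T v)        ≡⟨ cong (d v +_) (+-comm (R v) (T v)) ⟩
          d v + (T v + R v)        ≡⟨ sym (+-assoc (d v) (T v) (R v)) ⟩
          D v + R v                ≡⟨ sym (outdeg-dead dead) ⟩
          outdeg G′ (combine v j)  ∎))
    where open ≤-Reasoning
  ...   | yes live = j≡cv , subst (_< K v) j≡cv live , subst (d v ≤_) (residual-balanced bc v)
          (+-cancelʳ-≤ (T v) (d v) (residual c v) (begin
            d v + T v                ≡⟨ sym (outdeg-live live) ⟩
            outdeg G′ (combine v j)  ≤⟨ firable ⟩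
            Ψ c (combine v j)        ≡⟨ Ψ-current c≤K j≡cv ⟩
            residual c v + T v       ∎))
    where open ≤-Reasoning

  lift-step : ∀ {c y v} → c ≤̇ K → Balanced α c y → c v < K v → d v ≤ y v → Step G′ (Ψ c) (Ψ (c +̇ unit v))
  lift-step {c} {v = v} c≤K bc cv<Kv fv =
    combine v j , current-copy-firable c≤K bc j≡cv cv<Kv fv , λ q → sym (fire-copy c≤K bc j≡cv cv<Kv fv q)
    where
    cv<M : c v < M
    cv<M = s≤s (≤-trans (c≤K v) (K≤N v))
    j = fromℕ< cv<M
    j≡cv : toℕ j ≡ c v
    j≡cv = Fin.toℕ-fromℕ< cv<M

  project-step : ∀ {c y σ τ} → c ≤̇ K → Balanced α c y → σ ≗ Ψ c → Step G′ σ τ →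
                 ∃[ v ] c v < K v × d v ≤ y v × τ ≗ Ψ (c +̇ unit v)
  project-step {c} {y} {σ} {τ} c≤K bc σ≗Ψc st with G′.step-respˡ σ≗Ψc st
  ... | p , firable , τ≗fire = ∀-combine Fired fired-copy p firable τ≗fire
    where
    Fired : Fin (n * M) → Set
    Fired p = outdeg G′ p ≤ Ψ c p → τ ≗ fire G′ (Ψ c) p → ∃[ v ] c v < K v × d v ≤ y v × τ ≗ Ψ (c +̇ unit v)
    fired-copy : ∀ v j → Fired (combine v j)
    fired-copy v j firable τ≗fire with firable-copy-current c≤K bc firable
    ... | j≡cv , cv<Kv , fv = v , cv<Kv , fv , λ q → trans (τ≗fire q) (fire-copy c≤K bc j≡cv cv<Kv fv q)

  lift : ∀ {c c' y y'} → Balanced α c y → (r : Reach G y y') → c +shots r ≤̇ K → c' ≗ c +shots r →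
         Reach G′ (Ψ c) (Ψ c')
  lift {c} bc ε _ c'≗c = subst (Reach G′ (Ψ c)) (Ψ-cong (sym ∘ c'≗c)) ε
  lift {c} bc (s@(v , fv , _) ◅ r) c+r≤K c'≗c+r =
    lift-step c≤K bc cv<Kv fv ◅ lift (balanced-trans bc (balanced-step s)) r c+r≤K c'≗c+r
    where
    c≤K : c ≤̇ K
    c≤K w = ≤-trans (+shots-≥ c (s ◅ r) w) (c+r≤K w)
    cv<Kv : c v < K v
    cv<Kv = begin-strict
      c v                        <⟨ m<m+n (c v) (≤-reflexive (sym (unit-diag v))) ⟩
      c v + unit v v             ≤⟨ +shots-≥ (c +̇ unit v) r v ⟩
      ((c +̇ unit v) +shots r) v  ≤⟨ c+r≤K v ⟩
      K v                        ∎
      where open ≤-Reasoning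

  project : ∀ {c y σ τ} → c ≤̇ K → Balanced α c y → σ ≗ Ψ c → Reach G′ σ τ →
            ∃[ y' ] Σ (Reach G y y') λ r → c +shots r ≤̇ K × τ ≗ Ψ (c +shots r)
  project {y = y} c≤K bc σ≗Ψc ε = y , ε , c≤K , σ≗Ψc
  project {y = y} c≤K bc σ≗Ψc (st ◅ P) with project-step c≤K bc σ≗Ψc st
  ... | v , cv<Kv , fv , τ₁≗Ψ with project (+̇unit-≤̇ v c≤K cv<Kv) (balanced-trans bc (balanced-fire y v fv)) τ₁≗Ψ P
  ...   | y' , r , bounded , τ≗Ψ = y' , (v , fv , λ _ → refl) ◅ r , bounded , τ≗Ψ

  converges-from : ∀ {c y σ} → Acc _<_ (N ∸ sum c) → c ≤̇ K → Balanced α c y → σ ≗ Ψ c → Convergent G′ σ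
  converges-from {c} {y} {σ} (acc smaller) c≤K bc σ≗Ψc = acc next
    where
    next : ∀ {τ} → Step G′ σ τ → Convergent G′ τ
    next st with project-step c≤K bc σ≗Ψc st
    ... | v , cv<Kv , fv , τ≗Ψ = converges-from (smaller slack-decreases) c'≤K (balanced-trans bc (balanced-fire y v fv)) τ≗Ψ
      where
      c'≤K : c +̇ unit v ≤̇ K
      c'≤K = +̇unit-≤̇ v c≤K cv<Kv
      slack-decreases : N ∸ sum (c +̇ unit v) < N ∸ sum c
      slack-decreases = ∸-monoʳ-< (≤-reflexive (sym (∑-+̇unit c v))) (∑-mono-≤ c'≤K)

  converges : Convergent G′ (Ψ 0̇)
  converges = converges-from (<-wellFounded _) (λ _ → z≤n) (balanced-refl α) (λ _ → refl)

module IntervalEmbedding {c ℓ₁ ℓ₂} (L : Lattice c ℓ₁ ℓ₂) {n} {G : Multigraph n} {σ₀ : Config n}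
  (σ₀↓ : Convergent G σ₀) (f : Lattice.Carrier L → CS G σ₀)
  (f-iso : IsOrderIsomorphism (Lattice._≈_ L) (_≈CS_ G) (Lattice._≤_ L) (_≤CS_ G) f)
  {a b} (a≤b : Lattice._≤_ L a b) where

  open Lattice L using (Carrier; reflexive; module Eq) renaming (_≤_ to _⊑_)
  open Game G
  private module f = IsOrderIsomorphism f-iso

  conf : Carrier → Config n
  conf x = proj₁ (f x)

  α↓ : Convergent G (conf a)
  α↓ = convergent-after σ₀↓ (proj₂ (f a))

  a⇝b : Reach G (conf a) (conf b)
  a⇝b = f.mono a≤b

  K : Fin n → ℕ
  K = shots a⇝b

  module Budget = Budgeted G (conf a) K
  open Budget public using (G′; Ψ; converges)
  open Budget hiding (G′; Ψ; converges)

  from-a : (x : Interval L a b) → Reach G (conf a) (conf (proj₁ x))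
  from-a (_ , a≤x , _) = f.mono a≤x

  shots-from-a : Interval L a b → Fin n → ℕ
  shots-from-a x = shots (from-a x)

  shots-from-a≤K : ∀ x → shots-from-a x ≤̇ K
  shots-from-a≤K x@(_ , _ , x≤b) w = ≤-trans (+shots-≥ (shots-from-a x) x⇝b w) (≤-reflexive (begin
    (shots-from-a x +shots x⇝b) w  ≡⟨ cong-app (sym (+shots-◅◅ 0̇ (from-a x) x⇝b)) w ⟩
    shots (from-a x ◅◅ x⇝b) w      ≡⟨ shots-unique α↓ (from-a x ◅◅ x⇝b) a⇝b (λ _ → refl) w ⟩
    K w                            ∎))
    where
    open ≡-Reasoning
    x⇝b = f.mono x≤b

  reach⇒⊑ : ∀ {x x' σ τ} → conf x ≗ σ → Reach G σ τ → τ ≗ conf x' → x ⊑ x'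
  reach⇒⊑ x≗σ r τ≗x' with reach-resp (sym ∘ x≗σ) τ≗x' r
  ... | inj₁ x⇝x' = f.cancel x⇝x'
  ... | inj₂ x≗x' = reflexive (f.injective x≗x')

  embed : Interval L a b → CS G′ (Ψ 0̇)
  embed x = Ψ (shots-from-a x) , lift (balanced-refl (conf a)) (from-a x) (shots-from-a≤K x) (λ _ → refl)

  embed-cong : ∀ {x x'} → _≈I_ L {a} {b} x x' → _≈CS_ G′ (embed x) (embed x')
  embed-cong {x} {x'} x≈x' = cong-app (Ψ-cong (shots-unique α↓ (from-a x) (from-a x') (f.cong x≈x')))

  embed-mono : ∀ {x x'} → _≤I_ L {a} {b} x x' → _≤CS_ G′ (embed x) (embed x')
  embed-mono {x} {x'} x≤x' = lift (balanced-shots (from-a x)) x⇝x' bounded x'≗x+r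
    where
    x⇝x' = f.mono x≤x'
    x'≗x+r : shots-from-a x' ≗ shots-from-a x +shots x⇝x'
    x'≗x+r w = trans (shots-unique α↓ (from-a x') (from-a x ◅◅ x⇝x') (λ _ → refl) w)
                     (cong-app (+shots-◅◅ 0̇ (from-a x) x⇝x') w)
    bounded : shots-from-a x +shots x⇝x' ≤̇ K
    bounded w = subst (_≤ K w) (x'≗x+r w) (shots-from-a≤K x' w)

  embed-injective : ∀ {x x'} → _≈CS_ G′ (embed x) (embed x') → _≈I_ L {a} {b} x x'
  embed-injective {x} {x'} ex≗ex' = f.injective (balanced-unique (balanced-shots (from-a x)) (balanced-shots (from-a x'))
    (Ψ-injective (shots-from-a≤K x) (shots-from-a≤K x') ex≗ex'))

  embed-cancel : ∀ {x x'} → _≤CS_ G′ (embed x) (embed x') → _≤I_ L {a} {b} x x'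
  embed-cancel {x} {x'} ex⇝ex' with project (shots-from-a≤K x) (balanced-shots (from-a x)) (λ _ → refl) ex⇝ex'
  ... | y , r , bounded , ex'≗ = reach⇒⊑ (λ _ → refl) r (balanced-unique
        (balanced-+shots (balanced-shots (from-a x)) r) (balanced-shots (from-a x'))
        (sym ∘ Ψ-injective (shots-from-a≤K x') bounded ex'≗))

  embed-surjective : ∀ s → ∃ λ x → ∀ {z} → _≈I_ L {a} {b} z x → _≈CS_ G′ (embed z) s
  embed-surjective (τ , P) with project (λ _ → z≤n) (balanced-refl (conf a)) (λ _ → refl) P
  ... | y , r , bounded , τ≗ with f.surjective (y , proj₂ (f a) ◅◅ r)
  ...   | x₀ , fx₀≈ = (x₀ , a≤x₀ , x₀≤b) , λ {z} z≈x₀ w →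
          trans (cong-app (Ψ-cong (shots-unique α↓ (from-a z) r (fx₀≈ z≈x₀))) w) (sym (τ≗ w))
    where
    x₀≗y : conf x₀ ≗ y
    x₀≗y = fx₀≈ Eq.refl
    a≤x₀ : a ⊑ x₀
    a≤x₀ = reach⇒⊑ (λ _ → refl) r (sym ∘ x₀≗y)
    x₀≤b : x₀ ⊑ b
    x₀≤b with dominated-play-extends α↓ a⇝b r bounded
    ... | β' , q , β'≗b = reach⇒⊑ x₀≗y q β'≗b

  embed-isOrderIsomorphism : IsOrderIsomorphism (_≈I_ L) (_≈CS_ G′ {Ψ 0̇}) (_≤I_ L) (_≤CS_ G′ {Ψ 0̇}) embed
  embed-isOrderIsomorphism = record
    { isOrderMonomorphism = record
      { isOrderHomomorphism = record
        { cong = λ {x} {x'} → embed-cong {x} {x'}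
        ; mono = λ {x} {x'} → embed-mono {x} {x'}
        }
      ; injective = λ {x} {x'} → embed-injective {x} {x'}
      ; cancel = λ {x} {x'} → embed-cancel {x} {x'}
      }
    ; surjective = embed-surjective
    }

mainTheorem2 : ∀ {c ℓ₁ ℓ₂} (L : Lattice c ℓ₁ ℓ₂) →
    IsCFGSpace (Lattice.Carrier L) (Lattice._≈_ L) (Lattice._≤_ L) →
    ∀ a b → Lattice._≤_ L a b →
    IsCFGSpace (Interval L a b) (_≈I_ L) (_≤I_ L)
mainTheorem2 L (_ , _ , _ , σ₀↓ , f , f-iso) a b a≤b = _ , G′ , Ψ 0̇ , converges , embed , embed-isOrderIsomorphism
  where open IntervalEmbedding L σ₀↓ f f-iso a≤b
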